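{- (i) For all decidable subsets $B,C$ of $\omega$, if $B$ and $C$ are almost-finite, then $B\cup C$ is almost-finite. (ii) Let $B$ be a decidable subset of $\omega$. If there exists an infinite sequence $B_0,B_1,B_2,\dots$ of decidable, almost-finite subsets of $\omega$ such that $B=\bigcup_nB_n$ and $\forall\zeta\in[\omega]^\omega\,\exists i[B_{\zeta(i)}=\emptyset]$, then $B$ is almost-finite.
   Context: Setting: intuitionistic mathematics (intuitionistic logic), assuming the axioms of countable choice. $B\subseteq\omega$ is decidable iff $\exists\alpha\in\omega^\omega\forall n[n\in B\leftrightarrow\alpha(n)\neq0]$ (an infinite sequence of decidable sets is given by a sequence of such characteristic functions). $[\omega]^\omega=\{\zeta\in\omega^\omega\mid\forall n[\zeta(n)<\zeta(n+1)]\}$. A decidable $B\subseteq\omega$ is almost-finite iff $\forall\zeta\in[\omega]^\omega\,\exists i[\zeta(i)\notin B]$. -}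

module Defs where

open import Data.Nat using (ℕ; suc; _<_)
open import Data.Product using (Σ; ∃; _×_)
open import Data.Sum using (_⊎_)
open import Relation.Nullary using (¬_)
open import Relation.Binary.PropositionalEquality using (_≡_; _≢_)
open import Function.Bundles using (_⇔_)

-- A decidable subset of ω is given by a characteristic function α : ℕ → ℕ,
-- with n ∈ B iff α n ≠ 0.
DecSet : Set
DecSet = ℕ → ℕ

_∈_ : ℕ → DecSet → Set
n ∈ B = B n ≢ 0

_∉_ : ℕ → DecSet → Set
n ∉ B = ¬ (n ∈ B)

-- [ω]^ω : strictly increasing sequences
StrictInc : (ℕ → ℕ) → Set
StrictInc ζ = ∀ n → ζ n < ζ (suc n)

AlmostFinite : DecSet → Set
AlmostFinite B = ∀ ζ → StrictInc ζ → ∃ λ i → ζ i ∉ B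

IsUnion : DecSet → DecSet → DecSet → Set
IsUnion D B C = ∀ n → (n ∈ D) ⇔ (n ∈ B ⊎ n ∈ C)

IsBigUnion : DecSet → (ℕ → DecSet) → Set
IsBigUnion B Bs = ∀ n → (n ∈ B) ⇔ (∃ λ k → n ∈ Bs k)

IsEmpty : DecSet → Set
IsEmpty B = ∀ n → n ∉ B

-- Every almost-finite B lets us thin a strictly increasing ζ to a subsequence
-- that avoids B altogether.  Thinning once more gives (i).  For (ii), thinning
-- successively against B₀, …, B_p yields a point of ζ that avoids all of them,
-- so if it lies in B it lies in some B_k with k > p.  Enumerating such k
-- increasingly gives a sequence τ; some B_{τ i} is empty, and the point of ζ
-- attached to τ i must then lie outside B.
module Submission where

open import Defs
open import Data.Nat using (ℕ; zero; suc; _+_; _<_; _≤?_; _≟_; s≤s)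
open import Data.Nat.Properties
  using (<-trans; n<1+n; m≤n+m; m<1+n⇒m<n∨m≡n; ≰⇒>)
open import Data.Product using (Σ; ∃; _×_; _,_; proj₁; proj₂)
open import Data.Sum using (inj₁; inj₂; [_,_]′)
open import Data.Empty using (⊥-elim)
open import Function using (id; _∘_)
open import Function.Bundles using (Equivalence)
open import Relation.Nullary using (yes; no)
open import Relation.Binary.PropositionalEquality using (refl)

strictInc-mono : ∀ {ζ} → StrictInc ζ → ∀ {a b} → a < b → ζ a < ζ b
strictInc-mono ζ↑ {b = suc b} a<1+b with m<1+n⇒m<n∨m≡n a<1+b
... | inj₁ a<b  = <-trans (strictInc-mono ζ↑ a<b) (ζ↑ b)
... | inj₂ refl = ζ↑ b

strictInc-∘ : ∀ {ζ σ} → StrictInc ζ → StrictInc σ → StrictInc (ζ ∘ σ)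
strictInc-∘ ζ↑ σ↑ n = strictInc-mono ζ↑ (σ↑ n)

Unbounded : (ℕ → Set) → Set
Unbounded P = ∀ p → ∃ λ i → p < i × P i

enumerate : ∀ {P} → Unbounded P → Σ (ℕ → ℕ) λ σ → StrictInc σ × (∀ m → P (σ m))
enumerate {P} unb = σ , σ↑ , σ∈P
  where
  σ : ℕ → ℕ
  σ zero    = proj₁ (unb 0)
  σ (suc m) = proj₁ (unb (σ m))

  σ↑ : StrictInc σ
  σ↑ m = proj₁ (proj₂ (unb (σ m)))

  σ∈P : ∀ m → P (σ m)
  σ∈P zero    = proj₂ (proj₂ (unb 0))
  σ∈P (suc m) = proj₂ (proj₂ (unb (σ m)))

Avoids : (ℕ → ℕ) → DecSet → Set
Avoids η B = ∀ m → η m ∉ B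

almostFinite⇒unbounded-∉ : ∀ B {ζ} → AlmostFinite B → StrictInc ζ →
                           Unbounded (λ i → ζ i ∉ B)
almostFinite⇒unbounded-∉ B {ζ} afB ζ↑ p
  with afB (λ n → ζ (suc (n + p))) (λ n → ζ↑ (suc (n + p)))
... | i , ∉B = suc (i + p) , s≤s (m≤n+m p i) , ∉B

avoidingSubseq : ∀ B {ζ} → AlmostFinite B → StrictInc ζ →
                 Σ (ℕ → ℕ) λ σ → StrictInc σ × Avoids (ζ ∘ σ) B
avoidingSubseq B afB ζ↑ = enumerate (almostFinite⇒unbounded-∉ B afB ζ↑)

almostFinite-∪ : (B C D : DecSet) → AlmostFinite B → AlmostFinite C →
                 IsUnion D B C → AlmostFinite D
almostFinite-∪ B C D afB afC D≡B∪C ζ ζ↑ with avoidingSubseq B afB ζ↑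
... | σ , σ↑ , ∉B with afC (ζ ∘ σ) (strictInc-∘ ζ↑ σ↑)
... | j , ∉C = σ j , [ ∉B j , ∉C ]′ ∘ Equivalence.to (D≡B∪C (ζ (σ j)))

avoidingSubseq-< : ∀ (Bs : ℕ → DecSet) {ζ} → (∀ k → AlmostFinite (Bs k)) →
                   StrictInc ζ → ∀ c →
                   Σ (ℕ → ℕ) λ σ → StrictInc σ × (∀ j → j < c → Avoids (ζ ∘ σ) (Bs j))
avoidingSubseq-< Bs af ζ↑ zero = id , n<1+n , λ _ ()
avoidingSubseq-< Bs {ζ} af ζ↑ (suc c) with avoidingSubseq-< Bs af ζ↑ c
... | σ , σ↑ , ∉Bs< with avoidingSubseq (Bs c) (af c) (strictInc-∘ ζ↑ σ↑)
... | ρ , ρ↑ , ∉Bc = σ ∘ ρ , strictInc-∘ σ↑ ρ↑ , ∉Bs≤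
  where
  ∉Bs≤ : ∀ j → j < suc c → Avoids (ζ ∘ σ ∘ ρ) (Bs j)
  ∉Bs≤ j j<1+c m with m<1+n⇒m<n∨m≡n j<1+c
  ... | inj₁ j<c  = ∉Bs< j j<c (ρ m)
  ... | inj₂ refl = ∉Bc m

coveredBeyond : ∀ B Bs → IsBigUnion B Bs → ∀ p x → (∀ j → j < suc p → x ∉ Bs j) →
                ∃ λ k → p < k × (x ∈ B → x ∈ Bs k)
coveredBeyond B Bs B≡⋃Bs p x ∉Bs≤p with B x ≟ 0
... | yes x∉B = suc p , n<1+n p , λ x∈B → ⊥-elim (x∈B x∉B)
... | no x∈B with Equivalence.to (B≡⋃Bs x) x∈B
...   | k , x∈Bk with k ≤? p
...     | yes k≤p = ⊥-elim (∉Bs≤p k (s≤s k≤p) x∈Bk)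
...     | no k≰p  = k , ≰⇒> k≰p , λ _ → x∈Bk

unbounded-coveringIndices : ∀ B Bs {ζ} → (∀ k → AlmostFinite (Bs k)) → IsBigUnion B Bs →
                     StrictInc ζ → Unbounded (λ k → ∃ λ i → ζ i ∈ B → ζ i ∈ Bs k)
unbounded-coveringIndices B Bs {ζ} af B≡⋃Bs ζ↑ p =
  let σ , _ , ∉Bs≤p = avoidingSubseq-< Bs af ζ↑ (suc p)
      k , p<k , ∈B⇒∈Bk = coveredBeyond B Bs B≡⋃Bs p (ζ (σ 0)) (λ j j≤p → ∉Bs≤p j j≤p 0)
  in k , p<k , σ 0 , ∈B⇒∈Bk

almostFinite-⋃ : (B : DecSet) →
                 (∃ λ (Bs : ℕ → DecSet) →
                    (∀ k → AlmostFinite (Bs k))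
                    × IsBigUnion B Bs
                    × (∀ ζ → StrictInc ζ → ∃ λ i → IsEmpty (Bs (ζ i)))) →
                 AlmostFinite B
almostFinite-⋃ B (Bs , af , B≡⋃Bs , emptyAlong) ζ ζ↑ =
  let τ , τ↑ , covers = enumerate (unbounded-coveringIndices B Bs af B≡⋃Bs ζ↑)
      i , Bτi-empty = emptyAlong τ τ↑
      n , ∈B⇒∈Bτi = covers i
  in n , λ ∈B → Bτi-empty (ζ n) (∈B⇒∈Bτi ∈B)

lemma7p3 :
    ((B C D : DecSet) → AlmostFinite B → AlmostFinite C → IsUnion D B C → AlmostFinite D)
    × ((B : DecSet) →
       (∃ λ (Bs : ℕ → DecSet) →
          (∀ k → AlmostFinite (Bs k))
          × IsBigUnion B Bs
          × (∀ ζ → StrictInc ζ → ∃ λ i → IsEmpty (Bs (ζ i)))) →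
       AlmostFinite B)
lemma7p3 = almostFinite-∪ , almostFinite-⋃
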